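{- For any set $\mathbf{SL}$ of Scott-Lemmon axioms, cut elimination holds for $\mathbf{SKt}+\mathbf{SL}$.
   Context: Formulae are in negation normal form over $a,\neg a,\lor,\land,\square,\blacksquare,\lozenge,\lozenge^{\bullet}$, where $\lozenge^{\bullet}$ is the past diamond (dual of $\blacksquare$), $\overline A$ is the nnf of $\neg A$. $\mathbf{SKt}$ is the shallow nested sequent calculus: $id$: $\Gamma,a,\overline a$; $cut$: from $\Gamma,A$ and $\Delta,\overline A$ infer $\Gamma,\Delta$; $\land$, $\lor$; $ctr$: from $\Gamma,\Delta,\Delta$ infer $\Gamma,\Delta$; $wk$: from $\Gamma$ infer $\Gamma,\Delta$; $rf$: from $\Gamma,\circ\{\Delta\}$ infer $\bullet\{\Gamma\},\Delta$; $rp$: from $\Gamma,\bullet\{\Delta\}$ infer $\circ\{\Gamma\},\Delta$; $\blacksquare$: from $\Gamma,\bullet\{A\}$ infer $\Gamma,\blacksquare A$; $\square$: from $\Gamma,\circ\{A\}$ infer $\Gamma,\square A$; $\lozenge^{\bullet}$: from $\Gamma,\bullet\{\Delta,A\}$ infer $\Gamma,\bullet\{\Delta\},\lozenge^{\bullet}A$; $\lozenge$: from $\Gamma,\circ\{\Delta,A\}$ infer $\Gamma,\circ\{\Delta\},\lozenge A$. A Scott-Lemmon axiom $\lozenge^h\square^i A\to\square^j\lozenge^k A$ has primitive form $(\lozenge^{\bullet})^h\lozenge^j A\to\lozenge^i(\lozenge^{\bullet})^k A$; $\mathbf{SKt}+\mathbf{SL}$ is $\mathbf{SKt}$ plus,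 for each axiom in $\mathbf{SL}$, the structural rule $sl(h,i,j,k)$: from $\Gamma,\circ^i\{\bullet^k\{\Delta\}\}$ infer $\Gamma,\bullet^h\{\circ^j\{\Delta\}\}$ ($\circ^n$, $\bullet^n$ denoting $n$-fold nesting). -}

module Defs where

open import Data.Nat using (ℕ; zero; suc)
open import Data.List using (List; []; _∷_; _++_)
open import Data.Bool using (Bool; true; false; T)

-- Formulae in negation normal form; propositional atoms are natural numbers.
data Fm : Set where
  atom  : ℕ → Fm
  natom : ℕ → Fm
  _∨_   : Fm → Fm → Fm
  _∧_   : Fm → Fm → Fm
  □     : Fm → Fm         -- future box
  ■     : Fm → Fm         -- past box
  ◇     : Fm → Fm         -- future diamond
  ◆     : Fm → Fm         -- past diamond (dual of ■)

neg : Fm → Fm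
neg (atom a)  = natom a
neg (natom a) = atom a
neg (A ∨ B)   = neg A ∧ neg B
neg (A ∧ B)   = neg A ∨ neg B
neg (□ A)     = ◇ (neg A)
neg (■ A)     = ◆ (neg A)
neg (◇ A)     = □ (neg A)
neg (◆ A)     = ■ (neg A)

-- Nested sequents: a sequent is a (multi)set of items, each a formula,
-- a white structure ∘{Δ} or a black structure •{Δ}.
mutual
  data Item : Set where
    fm : Fm → Item
    wh : Seq → Item
    bl : Seq → Item

  Seq : Set
  Seq = List Item

-- Sequents are multisets (at every nesting level): equivalence up to
-- permutation, congruent under ∘{ } and •{ }.
mutual
  data _∼_ : Item → Item → Set where
    fm≈ : ∀ {A} → fm A ∼ fm A
    wh≈ : ∀ {Γ Δ} → Γ ≈ Δ → wh Γ ∼ wh Δ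
    bl≈ : ∀ {Γ Δ} → Γ ≈ Δ → bl Γ ∼ bl Δ

  data _≈_ : Seq → Seq → Set where
    []≈   : [] ≈ []
    ∷≈    : ∀ {x y Γ Δ} → x ∼ y → Γ ≈ Δ → (x ∷ Γ) ≈ (y ∷ Δ)
    swap≈ : ∀ {x y Γ} → (x ∷ y ∷ Γ) ≈ (y ∷ x ∷ Γ)
    trans≈ : ∀ {Γ Δ Σ} → Γ ≈ Δ → Δ ≈ Σ → Γ ≈ Σ

whⁿ : ℕ → Seq → Seq
whⁿ zero    Δ = Δ
whⁿ (suc n) Δ = wh (whⁿ n Δ) ∷ []

blⁿ : ℕ → Seq → Seq
blⁿ zero    Δ = Δ
blⁿ (suc n) Δ = bl (blⁿ n Δ) ∷ []

-- A set of Scott-Lemmon axioms ◇ʰ□ⁱA → □ʲ◇ᵏA, given by its parameters (h,i,j,k).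
SLSet : Set₁
SLSet = ℕ → ℕ → ℕ → ℕ → Set

-- Derivability in SKt + SL.  The flag c says whether cut is allowed.
data Der (SL : SLSet) (c : Bool) : Seq → Set where
  ex   : ∀ {Γ Γ'} → Γ' ≈ Γ → Der SL c Γ' → Der SL c Γ
  id   : ∀ {Γ a} → Der SL c (Γ ++ fm (atom a) ∷ fm (natom a) ∷ [])
  cut  : ∀ {Γ Δ A} → T c → Der SL c (Γ ++ fm A ∷ []) → Der SL c (Δ ++ fm (neg A) ∷ [])
         → Der SL c (Γ ++ Δ)
  ∧r   : ∀ {Γ A B} → Der SL c (Γ ++ fm A ∷ []) → Der SL c (Γ ++ fm B ∷ [])
         → Der SL c (Γ ++ fm (A ∧ B) ∷ [])
  ∨r   : ∀ {Γ A B} → Der SL c (Γ ++ fm A ∷ fm B ∷ []) → Der SL c (Γ ++ fm (A ∨ B) ∷ [])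
  ctr  : ∀ {Γ Δ} → Der SL c (Γ ++ Δ ++ Δ) → Der SL c (Γ ++ Δ)
  wk   : ∀ {Γ Δ} → Der SL c Γ → Der SL c (Γ ++ Δ)
  rf   : ∀ {Γ Δ} → Der SL c (Γ ++ wh Δ ∷ []) → Der SL c (bl Γ ∷ Δ)
  rp   : ∀ {Γ Δ} → Der SL c (Γ ++ bl Δ ∷ []) → Der SL c (wh Γ ∷ Δ)
  ■r   : ∀ {Γ A} → Der SL c (Γ ++ bl (fm A ∷ []) ∷ []) → Der SL c (Γ ++ fm (■ A) ∷ [])
  □r   : ∀ {Γ A} → Der SL c (Γ ++ wh (fm A ∷ []) ∷ []) → Der SL c (Γ ++ fm (□ A) ∷ [])
  ◆r   : ∀ {Γ Δ A} → Der SL c (Γ ++ bl (Δ ++ fm A ∷ []) ∷ [])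
         → Der SL c (Γ ++ bl Δ ∷ fm (◆ A) ∷ [])
  ◇r   : ∀ {Γ Δ A} → Der SL c (Γ ++ wh (Δ ++ fm A ∷ []) ∷ [])
         → Der SL c (Γ ++ wh Δ ∷ fm (◇ A) ∷ [])
  sl   : ∀ {Γ Δ h i j k} → SL h i j k
         → Der SL c (Γ ++ whⁿ i (blⁿ k Δ))
         → Der SL c (Γ ++ blⁿ h (whⁿ j Δ))

SKt+ : SLSet → Seq → Set
SKt+ SL = Der SL true

SKt+-cutfree : SLSet → Seq → Set
SKt+-cutfree SL = Der SL false

-- Cut on A is admissible by induction on A; no induction on derivation height
-- is needed.  Given cut-free derivations of Γ, A and Δ, Ā, replace the
-- occurrence of A, together with all its ancestors, by Δ throughout the first
-- derivation.  Every rule survives this substitution except where an ancestor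
-- of A is principal; there the premises of the rule introducing A are at hand,
-- and Δ, Ā is processed the same way, now replacing Ā by the context of that
-- rule, which leaves only cuts on immediate subformulas of A.  A cut under ∘{ }
-- or •{ } is brought to the top by the display rules rf and rp.  The other
-- structural rules, the Scott-Lemmon rules sl included, never act on a formula,
-- so they commute with the substitution whatever SL is.

module Submission where

open import Data.Bool using (false)
open import Data.List using (List; []; _∷_; _++_)
open import Data.List.Properties using (++-assoc; ++-identityʳ; ∷-injective)
import Data.List.Relation.Binary.Permutation.Propositional as ↭
open ↭ using (_↭_)
import Data.List.Relation.Binary.Permutation.Propositional.Properties as ↭ₚ
open import Data.Nat using (ℕ; zero; suc)
open import Data.Product using (∃; ∃₂; _×_; _,_)
open import Relation.Binary.PropositionalEquality
  using (_≡_; refl; sym; trans; cong; cong₂; subst)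

open import Defs

open import Algebra.Solver.CommutativeMonoid (↭ₚ.++-commutativeMonoid {A = Item})
  using (solve; _⊜_; _⊕_)

mutual
  ∼-refl : ∀ x → x ∼ x
  ∼-refl (fm A) = fm≈
  ∼-refl (wh Γ) = wh≈ (≈-refl Γ)
  ∼-refl (bl Γ) = bl≈ (≈-refl Γ)

  ≈-refl : ∀ Γ → Γ ≈ Γ
  ≈-refl []      = []≈
  ≈-refl (x ∷ Γ) = ∷≈ (∼-refl x) (≈-refl Γ)

↭⇒≈ : ∀ {Γ Δ} → Γ ↭ Δ → Γ ≈ Δ
↭⇒≈ ↭.refl         = ≈-refl _
↭⇒≈ (↭.prep x p)   = ∷≈ (∼-refl x) (↭⇒≈ p)
↭⇒≈ (↭.swap x y p) = trans≈ swap≈ (∷≈ (∼-refl y) (∷≈ (∼-refl x) (↭⇒≈ p)))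
↭⇒≈ (↭.trans p q)  = trans≈ (↭⇒≈ p) (↭⇒≈ q)

≈-++⁺ʳ : ∀ {Γ Δ} Σ → Γ ≈ Δ → (Γ ++ Σ) ≈ (Δ ++ Σ)
≈-++⁺ʳ Σ []≈          = ≈-refl Σ
≈-++⁺ʳ Σ (∷≈ x p)     = ∷≈ x (≈-++⁺ʳ Σ p)
≈-++⁺ʳ Σ swap≈        = swap≈
≈-++⁺ʳ Σ (trans≈ p q) = trans≈ (≈-++⁺ʳ Σ p) (≈-++⁺ʳ Σ q)

≈-++⁺ˡ : ∀ Γ {Δ Σ} → Δ ≈ Σ → (Γ ++ Δ) ≈ (Γ ++ Σ)
≈-++⁺ˡ []      p = p
≈-++⁺ˡ (x ∷ Γ) p = ∷≈ (∼-refl x) (≈-++⁺ˡ Γ p)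

≈-++⁺ : ∀ {Γ Δ Σ Π} → Γ ≈ Δ → Σ ≈ Π → (Γ ++ Σ) ≈ (Δ ++ Π)
≈-++⁺ {Δ = Δ} {Σ} p q = trans≈ (≈-++⁺ʳ Σ p) (≈-++⁺ˡ Δ q)

mutual
  data MItem : Set where
    fm   : Fm → MItem
    hole : MItem
    wh   : MSeq → MItem
    bl   : MSeq → MItem

  MSeq : Set
  MSeq = List MItem

mutual
  ⌈_⌉ᵢ : Item → MItem
  ⌈ fm A ⌉ᵢ = fm A
  ⌈ wh Γ ⌉ᵢ = wh ⌈ Γ ⌉
  ⌈ bl Γ ⌉ᵢ = bl ⌈ Γ ⌉

  ⌈_⌉ : Seq → MSeq
  ⌈ [] ⌉    = []
  ⌈ x ∷ Γ ⌉ = ⌈ x ⌉ᵢ ∷ ⌈ Γ ⌉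

whⁿᴹ : ℕ → MSeq → MSeq
whⁿᴹ zero    N = N
whⁿᴹ (suc n) N = wh (whⁿᴹ n N) ∷ []

blⁿᴹ : ℕ → MSeq → MSeq
blⁿᴹ zero    N = N
blⁿᴹ (suc n) N = bl (blⁿᴹ n N) ∷ []

-- Holes mark the occurrences of C (ancestors of a cut formula) to be replaced by S.
module Marking (C : Fm) (S : Seq) where

  mutual
    ⌊_⌋ᵢ : MItem → Item
    ⌊ fm A ⌋ᵢ = fm A
    ⌊ hole ⌋ᵢ = fm C
    ⌊ wh N ⌋ᵢ = wh ⌊ N ⌋
    ⌊ bl N ⌋ᵢ = bl ⌊ N ⌋

    ⌊_⌋ : MSeq → Seq
    ⌊ [] ⌋    = []
    ⌊ m ∷ M ⌋ = ⌊ m ⌋ᵢ ∷ ⌊ M ⌋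

  mutual
    fillᵢ : MItem → Seq
    fillᵢ (fm A) = fm A ∷ []
    fillᵢ hole   = S
    fillᵢ (wh N) = wh (fill N) ∷ []
    fillᵢ (bl N) = bl (fill N) ∷ []

    fill : MSeq → Seq
    fill []      = []
    fill (m ∷ M) = fillᵢ m ++ fill M

  mutual
    ⌊⌈⌉ᵢ⌋ᵢ : ∀ x → ⌊ ⌈ x ⌉ᵢ ⌋ᵢ ≡ x
    ⌊⌈⌉ᵢ⌋ᵢ (fm A) = refl
    ⌊⌈⌉ᵢ⌋ᵢ (wh Γ) = cong wh (⌊⌈⌉⌋ Γ)
    ⌊⌈⌉ᵢ⌋ᵢ (bl Γ) = cong bl (⌊⌈⌉⌋ Γ)

    ⌊⌈⌉⌋ : ∀ Γ → ⌊ ⌈ Γ ⌉ ⌋ ≡ Γ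
    ⌊⌈⌉⌋ []      = refl
    ⌊⌈⌉⌋ (x ∷ Γ) = cong₂ _∷_ (⌊⌈⌉ᵢ⌋ᵢ x) (⌊⌈⌉⌋ Γ)

  mutual
    fillᵢ-⌈⌉ᵢ : ∀ x → fillᵢ ⌈ x ⌉ᵢ ≡ x ∷ []
    fillᵢ-⌈⌉ᵢ (fm A) = refl
    fillᵢ-⌈⌉ᵢ (wh Γ) = cong (λ Π → wh Π ∷ []) (fill-⌈⌉ Γ)
    fillᵢ-⌈⌉ᵢ (bl Γ) = cong (λ Π → bl Π ∷ []) (fill-⌈⌉ Γ)

    fill-⌈⌉ : ∀ Γ → fill ⌈ Γ ⌉ ≡ Γ
    fill-⌈⌉ []      = refl
    fill-⌈⌉ (x ∷ Γ) = cong₂ _++_ (fillᵢ-⌈⌉ᵢ x) (fill-⌈⌉ Γ)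

  ⌊⌋-++ : ∀ M N → ⌊ M ++ N ⌋ ≡ ⌊ M ⌋ ++ ⌊ N ⌋
  ⌊⌋-++ []      N = refl
  ⌊⌋-++ (m ∷ M) N = cong (⌊ m ⌋ᵢ ∷_) (⌊⌋-++ M N)

  fill-++ : ∀ M N → fill (M ++ N) ≡ fill M ++ fill N
  fill-++ []      N = refl
  fill-++ (m ∷ M) N = trans (cong (fillᵢ m ++_) (fill-++ M N))
                            (sym (++-assoc (fillᵢ m) (fill M) (fill N)))

  fill-hole : fill (hole ∷ []) ≡ S
  fill-hole = ++-identityʳ S

  ⌊⌋-whⁿ : ∀ n N → ⌊ whⁿᴹ n N ⌋ ≡ whⁿ n ⌊ N ⌋
  ⌊⌋-whⁿ zero    N = refl
  ⌊⌋-whⁿ (suc n) N = cong (λ Π → wh Π ∷ []) (⌊⌋-whⁿ n N)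

  ⌊⌋-blⁿ : ∀ n N → ⌊ blⁿᴹ n N ⌋ ≡ blⁿ n ⌊ N ⌋
  ⌊⌋-blⁿ zero    N = refl
  ⌊⌋-blⁿ (suc n) N = cong (λ Π → bl Π ∷ []) (⌊⌋-blⁿ n N)

  fill-whⁿ : ∀ n N → fill (whⁿᴹ n N) ≡ whⁿ n (fill N)
  fill-whⁿ zero    N = refl
  fill-whⁿ (suc n) N = cong (λ Π → wh Π ∷ []) (fill-whⁿ n N)

  fill-blⁿ : ∀ n N → fill (blⁿᴹ n N) ≡ blⁿ n (fill N)
  fill-blⁿ zero    N = refl
  fill-blⁿ (suc n) N = cong (λ Π → bl Π ∷ []) (fill-blⁿ n N)

  ⌊⌋-++⁻ : ∀ Γ {Δ} M → ⌊ M ⌋ ≡ Γ ++ Δ →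
           ∃₂ λ M₁ M₂ → M ≡ M₁ ++ M₂ × ⌊ M₁ ⌋ ≡ Γ × ⌊ M₂ ⌋ ≡ Δ
  ⌊⌋-++⁻ []      M       eq = [] , M , refl , refl , eq
  ⌊⌋-++⁻ (x ∷ Γ) []      ()
  ⌊⌋-++⁻ (x ∷ Γ) (m ∷ M) eq with ∷-injective eq
  ... | refl , eq′ with ⌊⌋-++⁻ Γ M eq′
  ... | M₁ , M₂ , refl , refl , e = m ∷ M₁ , M₂ , refl , refl , e

  data Occurrence (A : Fm) : MSeq → Set where
    unmarked : Occurrence A (fm A ∷ [])
    marked   : C ≡ A → Occurrence A (hole ∷ [])

  occurrence : ∀ {A} M → ⌊ M ⌋ ≡ fm A ∷ [] → Occurrence A M
  occurrence (fm A ∷ [])  refl = unmarked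
  occurrence (hole ∷ [])  refl = marked refl
  occurrence (wh _ ∷ _)   ()
  occurrence (bl _ ∷ _)   ()
  occurrence (_ ∷ _ ∷ _)  ()
  occurrence []           ()

  ⌊⌋-wh⁻ : ∀ {Γ} M → ⌊ M ⌋ ≡ wh Γ ∷ [] → ∃ λ N → M ≡ wh N ∷ [] × ⌊ N ⌋ ≡ Γ
  ⌊⌋-wh⁻ (wh N ∷ [])  refl = N , refl , refl
  ⌊⌋-wh⁻ (fm _ ∷ _)   ()
  ⌊⌋-wh⁻ (hole ∷ _)   ()
  ⌊⌋-wh⁻ (bl _ ∷ _)   ()
  ⌊⌋-wh⁻ (_ ∷ _ ∷ _)  ()
  ⌊⌋-wh⁻ []           ()

  ⌊⌋-bl⁻ : ∀ {Γ} M → ⌊ M ⌋ ≡ bl Γ ∷ [] → ∃ λ N → M ≡ bl N ∷ [] × ⌊ N ⌋ ≡ Γ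
  ⌊⌋-bl⁻ (bl N ∷ [])  refl = N , refl , refl
  ⌊⌋-bl⁻ (fm _ ∷ _)   ()
  ⌊⌋-bl⁻ (hole ∷ _)   ()
  ⌊⌋-bl⁻ (wh _ ∷ _)   ()
  ⌊⌋-bl⁻ (_ ∷ _ ∷ _)  ()
  ⌊⌋-bl⁻ []           ()

  ⌊⌋-whⁿ⁻ : ∀ n {Γ} M → ⌊ M ⌋ ≡ whⁿ n Γ → ∃ λ N → M ≡ whⁿᴹ n N × ⌊ N ⌋ ≡ Γ
  ⌊⌋-whⁿ⁻ zero    M eq = M , refl , eq
  ⌊⌋-whⁿ⁻ (suc n) M eq with ⌊⌋-wh⁻ M eq
  ... | N , refl , e with ⌊⌋-whⁿ⁻ n N e
  ... | N′ , refl , e′ = N′ , refl , e′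

  ⌊⌋-blⁿ⁻ : ∀ n {Γ} M → ⌊ M ⌋ ≡ blⁿ n Γ → ∃ λ N → M ≡ blⁿᴹ n N × ⌊ N ⌋ ≡ Γ
  ⌊⌋-blⁿ⁻ zero    M eq = M , refl , eq
  ⌊⌋-blⁿ⁻ (suc n) M eq with ⌊⌋-bl⁻ M eq
  ... | N , refl , e with ⌊⌋-blⁿ⁻ n N e
  ... | N′ , refl , e′ = N′ , refl , e′

  mutual
    marking-∼ : ∀ {x y} → x ∼ y → ∀ m → ⌊ m ⌋ᵢ ≡ y →
                ∃ λ m′ → ⌊ m′ ⌋ᵢ ≡ x × fillᵢ m′ ≈ fillᵢ m
    marking-∼ fm≈     m      eq = m , eq , ≈-refl _
    marking-∼ (wh≈ p) (wh N) refl with marking-≈ p N refl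
    ... | N′ , e , q = wh N′ , cong wh e , ∷≈ (wh≈ q) []≈
    marking-∼ (bl≈ p) (bl N) refl with marking-≈ p N refl
    ... | N′ , e , q = bl N′ , cong bl e , ∷≈ (bl≈ q) []≈

    marking-≈ : ∀ {Γ Δ} → Γ ≈ Δ → ∀ M → ⌊ M ⌋ ≡ Δ →
                ∃ λ M′ → ⌊ M′ ⌋ ≡ Γ × fill M′ ≈ fill M
    marking-≈ []≈          []          refl = [] , refl , []≈
    marking-≈ (∷≈ p q)     (m ∷ M)     refl with marking-∼ p m refl | marking-≈ q M refl
    ... | m′ , e , r | M′ , e′ , r′ = m′ ∷ M′ , cong₂ _∷_ e e′ , ≈-++⁺ r r′
    marking-≈ swap≈        (m ∷ n ∷ M) refl =
      n ∷ m ∷ M , refl , ↭⇒≈ (↭ₚ.shifts (fillᵢ n) (fillᵢ m))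
    marking-≈ (trans≈ p q) M           eq with marking-≈ q M eq
    ... | M′ , e , r with marking-≈ p M′ e
    ... | M″ , e′ , r′ = M″ , e′ , trans≈ r′ r

module _ (SL : SLSet) where

  infix 4 ⊢_
  ⊢_ : Seq → Set
  ⊢_ = Der SL false

  exchange : ∀ {Γ Δ} → Γ ↭ Δ → ⊢ Γ → ⊢ Δ
  exchange p = ex (↭⇒≈ p)

  -- Replacement C S: S may stand in for C wherever C is principal, i.e. the
  -- rule introducing C is admissible with S in place of C in its conclusion.
  Replacement : Fm → Seq → Set
  Replacement (atom a)  S = ∀ Γ → ⊢ Γ ++ S ++ fm (natom a) ∷ []
  Replacement (natom a) S = ∀ Γ → ⊢ Γ ++ fm (atom a) ∷ S
  Replacement (A ∨ B)   S = ∀ Γ → ⊢ Γ ++ fm A ∷ fm B ∷ [] → ⊢ Γ ++ S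
  Replacement (A ∧ B)   S = ∀ Γ → ⊢ Γ ++ fm A ∷ [] → ⊢ Γ ++ fm B ∷ [] → ⊢ Γ ++ S
  Replacement (□ A)     S = ∀ Γ → ⊢ Γ ++ wh (fm A ∷ []) ∷ [] → ⊢ Γ ++ S
  Replacement (■ A)     S = ∀ Γ → ⊢ Γ ++ bl (fm A ∷ []) ∷ [] → ⊢ Γ ++ S
  Replacement (◇ A)     S = ∀ Γ Δ → ⊢ Γ ++ wh (Δ ++ fm A ∷ []) ∷ [] → ⊢ Γ ++ wh Δ ∷ S
  Replacement (◆ A)     S = ∀ Γ Δ → ⊢ Γ ++ bl (Δ ++ fm A ∷ []) ∷ [] → ⊢ Γ ++ bl Δ ∷ S

  module Substitution (C : Fm) (S : Seq) (principal : Replacement C S) where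

    open Marking C S

    Fillable : Seq → Set
    Fillable Γ = ∀ M → ⌊ M ⌋ ≡ Γ → ⊢ fill M

    fill-premise : ∀ M₁ M₂ {Π Π′} → ⌊ M₂ ⌋ ≡ Π → fill M₂ ≡ Π′ →
                   Fillable (⌊ M₁ ⌋ ++ Π) → ⊢ fill M₁ ++ Π′
    fill-premise M₁ M₂ refl refl f = subst ⊢_ (fill-++ M₁ M₂) (f (M₁ ++ M₂) (⌊⌋-++ M₁ M₂))

    fill-conclusion : ∀ M₁ M₂ {Π} → fill M₂ ≡ Π → ⊢ fill M₁ ++ Π → ⊢ fill (M₁ ++ M₂)
    fill-conclusion M₁ M₂ refl = subst ⊢_ (sym (fill-++ M₁ M₂))

    fillable-ex : ∀ {Γ Δ} → Γ ≈ Δ → Fillable Γ → Fillable Δ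
    fillable-ex p f M eq with marking-≈ p M eq
    ... | M′ , e , q = ex q (f M′ e)

    fillable-id : ∀ Γ a → Fillable (Γ ++ fm (atom a) ∷ fm (natom a) ∷ [])
    fillable-id Γ a M eq with ⌊⌋-++⁻ Γ M eq
    ... | M₁ , M₂ , refl , refl , e with ⌊⌋-++⁻ (fm (atom a) ∷ []) M₂ e
    ... | M₃ , M₄ , refl , e₃ , e₄ with occurrence M₃ e₃ | occurrence M₄ e₄
    ... | unmarked    | unmarked    = fill-conclusion M₁ _ refl id
    ... | unmarked    | marked refl =
      fill-conclusion M₁ _ (cong (fm (atom a) ∷_) fill-hole) (principal (fill M₁))
    ... | marked refl | unmarked    = fill-conclusion M₁ _ refl (principal (fill M₁))
    ... | marked refl | marked ()

    fill-last : ∀ M₁ M₂ {A M₃} → Occurrence A M₃ → ⊢ fill M₁ ++ fill M₂ ++ fm A ∷ [] →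
                (C ≡ A → ⊢ fill M₁ ++ fill M₂ ++ S) → ⊢ fill (M₁ ++ M₂ ++ M₃)
    fill-last M₁ M₂ unmarked   d _ = fill-conclusion M₁ _ (fill-++ M₂ _) d
    fill-last M₁ M₂ (marked c) _ h =
      fill-conclusion M₁ _ (trans (fill-++ M₂ _) (cong (fill M₂ ++_) fill-hole)) (h c)

    fillable-∧r : ∀ {Γ A B} → Fillable (Γ ++ fm A ∷ []) → Fillable (Γ ++ fm B ∷ []) →
                  Fillable (Γ ++ fm (A ∧ B) ∷ [])
    fillable-∧r {Γ} {A} {B} f g M eq with ⌊⌋-++⁻ Γ M eq
    ... | M₁ , M₂ , refl , refl , e =
      fill-last M₁ [] (occurrence M₂ e) (∧r fA fB) λ { refl → principal (fill M₁) fA fB }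
      where
        fA : ⊢ fill M₁ ++ fm A ∷ []
        fA = fill-premise M₁ (fm A ∷ []) refl refl f
        fB : ⊢ fill M₁ ++ fm B ∷ []
        fB = fill-premise M₁ (fm B ∷ []) refl refl g

    fillable-∨r : ∀ {Γ A B} → Fillable (Γ ++ fm A ∷ fm B ∷ []) →
                  Fillable (Γ ++ fm (A ∨ B) ∷ [])
    fillable-∨r {Γ} {A} {B} f M eq with ⌊⌋-++⁻ Γ M eq
    ... | M₁ , M₂ , refl , refl , e =
      fill-last M₁ [] (occurrence M₂ e) (∨r fAB) λ { refl → principal (fill M₁) fAB }
      where
        fAB : ⊢ fill M₁ ++ fm A ∷ fm B ∷ []
        fAB = fill-premise M₁ (fm A ∷ fm B ∷ []) refl refl f

    fillable-□r : ∀ {Γ A} → Fillable (Γ ++ wh (fm A ∷ []) ∷ []) →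
                  Fillable (Γ ++ fm (□ A) ∷ [])
    fillable-□r {Γ} {A} f M eq with ⌊⌋-++⁻ Γ M eq
    ... | M₁ , M₂ , refl , refl , e =
      fill-last M₁ [] (occurrence M₂ e) (□r fA) λ { refl → principal (fill M₁) fA }
      where
        fA : ⊢ fill M₁ ++ wh (fm A ∷ []) ∷ []
        fA = fill-premise M₁ (wh (fm A ∷ []) ∷ []) refl refl f

    fillable-■r : ∀ {Γ A} → Fillable (Γ ++ bl (fm A ∷ []) ∷ []) →
                  Fillable (Γ ++ fm (■ A) ∷ [])
    fillable-■r {Γ} {A} f M eq with ⌊⌋-++⁻ Γ M eq
    ... | M₁ , M₂ , refl , refl , e =
      fill-last M₁ [] (occurrence M₂ e) (■r fA) λ { refl → principal (fill M₁) fA }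
      where
        fA : ⊢ fill M₁ ++ bl (fm A ∷ []) ∷ []
        fA = fill-premise M₁ (bl (fm A ∷ []) ∷ []) refl refl f

    fillable-◇r : ∀ {Γ Δ A} → Fillable (Γ ++ wh (Δ ++ fm A ∷ []) ∷ []) →
                  Fillable (Γ ++ wh Δ ∷ fm (◇ A) ∷ [])
    fillable-◇r {Γ} {Δ} {A} f M eq with ⌊⌋-++⁻ Γ M eq
    ... | M₁ , M₂ , refl , refl , e with ⌊⌋-++⁻ (wh Δ ∷ []) M₂ e
    ... | M₃ , M₄ , refl , e₃ , e₄ with ⌊⌋-wh⁻ M₃ e₃
    ... | N , refl , refl =
      fill-last M₁ (wh N ∷ []) (occurrence M₄ e₄) (◇r fNA)
        λ { refl → principal (fill M₁) (fill N) fNA }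
      where
        fNA : ⊢ fill M₁ ++ wh (fill N ++ fm A ∷ []) ∷ []
        fNA = fill-premise M₁ (wh (N ++ fm A ∷ []) ∷ [])
                (cong (λ Π → wh Π ∷ []) (⌊⌋-++ N _))
                (cong (λ Π → wh Π ∷ []) (fill-++ N _)) f

    fillable-◆r : ∀ {Γ Δ A} → Fillable (Γ ++ bl (Δ ++ fm A ∷ []) ∷ []) →
                  Fillable (Γ ++ bl Δ ∷ fm (◆ A) ∷ [])
    fillable-◆r {Γ} {Δ} {A} f M eq with ⌊⌋-++⁻ Γ M eq
    ... | M₁ , M₂ , refl , refl , e with ⌊⌋-++⁻ (bl Δ ∷ []) M₂ e
    ... | M₃ , M₄ , refl , e₃ , e₄ with ⌊⌋-bl⁻ M₃ e₃
    ... | N , refl , refl =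
      fill-last M₁ (bl N ∷ []) (occurrence M₄ e₄) (◆r fNA)
        λ { refl → principal (fill M₁) (fill N) fNA }
      where
        fNA : ⊢ fill M₁ ++ bl (fill N ++ fm A ∷ []) ∷ []
        fNA = fill-premise M₁ (bl (N ++ fm A ∷ []) ∷ [])
                (cong (λ Π → bl Π ∷ []) (⌊⌋-++ N _))
                (cong (λ Π → bl Π ∷ []) (fill-++ N _)) f

    fillable-ctr : ∀ {Γ Δ} → Fillable (Γ ++ Δ ++ Δ) → Fillable (Γ ++ Δ)
    fillable-ctr {Γ} f M eq with ⌊⌋-++⁻ Γ M eq
    ... | M₁ , M₂ , refl , refl , refl =
      fill-conclusion M₁ M₂ refl
        (ctr {Γ = fill M₁} {Δ = fill M₂}
          (fill-premise M₁ (M₂ ++ M₂) (⌊⌋-++ M₂ M₂) (fill-++ M₂ M₂) f))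

    fillable-wk : ∀ {Γ Δ} → Fillable Γ → Fillable (Γ ++ Δ)
    fillable-wk {Γ} f M eq with ⌊⌋-++⁻ Γ M eq
    ... | M₁ , M₂ , refl , refl , refl = fill-conclusion M₁ M₂ refl (wk (f M₁ refl))

    fillable-rf : ∀ {Γ Δ} → Fillable (Γ ++ wh Δ ∷ []) → Fillable (bl Γ ∷ Δ)
    fillable-rf f (bl N ∷ M) refl = rf (fill-premise N (wh M ∷ []) refl refl f)
    fillable-rf f (fm _ ∷ _) ()
    fillable-rf f (hole ∷ _) ()
    fillable-rf f (wh _ ∷ _) ()
    fillable-rf f []         ()

    fillable-rp : ∀ {Γ Δ} → Fillable (Γ ++ bl Δ ∷ []) → Fillable (wh Γ ∷ Δ)
    fillable-rp f (wh N ∷ M) refl = rp (fill-premise N (bl M ∷ []) refl refl f)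
    fillable-rp f (fm _ ∷ _) ()
    fillable-rp f (hole ∷ _) ()
    fillable-rp f (bl _ ∷ _) ()
    fillable-rp f []         ()

    fillable-sl : ∀ {Γ Δ h i j k} → SL h i j k →
                  Fillable (Γ ++ whⁿ i (blⁿ k Δ)) → Fillable (Γ ++ blⁿ h (whⁿ j Δ))
    fillable-sl {Γ} {h = h} {i} {j} {k} s f M eq with ⌊⌋-++⁻ Γ M eq
    ... | M₁ , M₂ , refl , refl , e with ⌊⌋-blⁿ⁻ h M₂ e
    ... | N , refl , e′ with ⌊⌋-whⁿ⁻ j N e′
    ... | N′ , refl , refl =
      fill-conclusion M₁ _ (trans (fill-blⁿ h _) (cong (blⁿ h) (fill-whⁿ j N′)))
        (sl s (fill-premise M₁ (whⁿᴹ i (blⁿᴹ k N′))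
                 (trans (⌊⌋-whⁿ i _) (cong (whⁿ i) (⌊⌋-blⁿ k N′)))
                 (trans (fill-whⁿ i _) (cong (whⁿ i) (fill-blⁿ k N′))) f))

    fillable : ∀ {Γ} → ⊢ Γ → Fillable Γ
    fillable (ex p d)        = fillable-ex p (fillable d)
    fillable id              = fillable-id _ _
    fillable (cut () _ _)
    fillable (∧r d e)        = fillable-∧r (fillable d) (fillable e)
    fillable (∨r d)          = fillable-∨r (fillable d)
    fillable (ctr {Γ} {Δ} d) = fillable-ctr {Γ} {Δ} (fillable d)
    fillable (wk {Δ = Δ} d)  = fillable-wk {Δ = Δ} (fillable d)
    fillable (rf d)          = fillable-rf (fillable d)
    fillable (rp d)          = fillable-rp (fillable d)
    fillable (■r d)          = fillable-■r (fillable d)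
    fillable (□r d)          = fillable-□r (fillable d)
    fillable (◆r d)          = fillable-◆r (fillable d)
    fillable (◇r d)          = fillable-◇r (fillable d)
    fillable (sl s d)        = fillable-sl s (fillable d)

    substitute : ∀ {Γ} → ⊢ Γ ++ fm C ∷ [] → ⊢ Γ ++ S
    substitute {Γ} d =
      subst (λ Π → ⊢ Π ++ S) (fill-⌈⌉ Γ)
        (fill-premise ⌈ Γ ⌉ (hole ∷ []) refl fill-hole
          (subst (λ Π → Fillable (Π ++ fm C ∷ [])) (sym (⌊⌈⌉⌋ Γ)) (fillable d)))

  CutAdmissible : Fm → Set
  CutAdmissible A = ∀ {Γ Δ} → ⊢ Γ ++ fm A ∷ [] → ⊢ Δ ++ fm (neg A) ∷ [] → ⊢ Γ ++ Δ

  wkˡ : ∀ Γ {Δ} x → ⊢ Δ ++ x ∷ [] → ⊢ (Γ ++ Δ) ++ x ∷ []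
  wkˡ Γ {Δ} x d =
    exchange (solve 3 (λ δ ξ γ → (δ ⊕ ξ) ⊕ γ ⊜ (γ ⊕ δ) ⊕ ξ) ↭.refl Δ (x ∷ []) Γ) (wk d)

  wkʳ : ∀ {Γ} Δ x → ⊢ Γ ++ x ∷ [] → ⊢ (Γ ++ Δ) ++ x ∷ []
  wkʳ {Γ} Δ x d =
    exchange (solve 3 (λ γ ξ δ → (γ ⊕ ξ) ⊕ δ ⊜ (γ ⊕ δ) ⊕ ξ) ↭.refl Γ (x ∷ []) Δ) (wk d)

  cut-inside-wh : ∀ {A Γ Δ X Y} → CutAdmissible A →
                  ⊢ Γ ++ wh (X ++ fm A ∷ []) ∷ [] → ⊢ Δ ++ wh (Y ++ fm (neg A) ∷ []) ∷ [] →
                  ⊢ wh (X ++ Y) ∷ Γ ++ Δ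
  cut-inside-wh {A} {Γ} {Δ} {X} {Y} cutA d e =
    rp (ctr {Γ = X ++ Y} {Δ = P} (exchange regroup (cutA {P ++ X} {P ++ Y} (rf d′) (rf e′))))
    where
      P : Seq
      P = bl (Γ ++ Δ) ∷ []
      d′ : ⊢ (Γ ++ Δ) ++ wh (X ++ fm A ∷ []) ∷ []
      d′ = wkʳ Δ _ d
      e′ : ⊢ (Γ ++ Δ) ++ wh (Y ++ fm (neg A) ∷ []) ∷ []
      e′ = wkˡ Γ _ e
      regroup : (P ++ X) ++ (P ++ Y) ↭ (X ++ Y) ++ P ++ P
      regroup = solve 3 (λ p x y → (p ⊕ x) ⊕ (p ⊕ y) ⊜ (x ⊕ y) ⊕ p ⊕ p) ↭.refl P X Y

  cut-inside-bl : ∀ {A Γ Δ X Y} → CutAdmissible A →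
                  ⊢ Γ ++ bl (X ++ fm A ∷ []) ∷ [] → ⊢ Δ ++ bl (Y ++ fm (neg A) ∷ []) ∷ [] →
                  ⊢ bl (X ++ Y) ∷ Γ ++ Δ
  cut-inside-bl {A} {Γ} {Δ} {X} {Y} cutA d e =
    rf (ctr {Γ = X ++ Y} {Δ = P} (exchange regroup (cutA {P ++ X} {P ++ Y} (rp d′) (rp e′))))
    where
      P : Seq
      P = wh (Γ ++ Δ) ∷ []
      d′ : ⊢ (Γ ++ Δ) ++ bl (X ++ fm A ∷ []) ∷ []
      d′ = wkʳ Δ _ d
      e′ : ⊢ (Γ ++ Δ) ++ bl (Y ++ fm (neg A) ∷ []) ∷ []
      e′ = wkˡ Γ _ e
      regroup : (P ++ X) ++ (P ++ Y) ↭ (X ++ Y) ++ P ++ P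
      regroup = solve 3 (λ p x y → (p ⊕ x) ⊕ (p ⊕ y) ⊜ (x ⊕ y) ⊕ p ⊕ p) ↭.refl P X Y

  open Substitution using (substitute)

  replacement-∧ : ∀ {A B Δ} → CutAdmissible A → CutAdmissible B →
                  ⊢ Δ ++ fm (neg (A ∧ B)) ∷ [] → Replacement (A ∧ B) Δ
  replacement-∧ {A} {B} {Δ} cutA cutB e Γ dA dB =
    exchange (↭ₚ.++-comm Δ Γ) (substitute (neg (A ∧ B)) Γ principal e)
    where
      principal : Replacement (neg (A ∧ B)) Γ
      principal Π d =
        ctr {Γ = Π} {Δ = Γ}
          (exchange (solve 2 (λ γ π → γ ⊕ γ ⊕ π ⊜ π ⊕ γ ⊕ γ) ↭.refl Γ Π) ΓΓΠ)
        where
          ΠB̄Ā : ⊢ (Π ++ fm (neg B) ∷ []) ++ fm (neg A) ∷ []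
          ΠB̄Ā = exchange (solve 3 (λ π α β → π ⊕ α ⊕ β ⊜ (π ⊕ β) ⊕ α) ↭.refl
                           Π (fm (neg A) ∷ []) (fm (neg B) ∷ [])) d
          ΓΠB̄ : ⊢ (Γ ++ Π) ++ fm (neg B) ∷ []
          ΓΠB̄ = subst ⊢_ (sym (++-assoc Γ Π _)) (cutA dA ΠB̄Ā)
          ΓΓΠ : ⊢ Γ ++ Γ ++ Π
          ΓΓΠ = cutB dB ΓΠB̄

  replacement-∨ : ∀ {A B Δ} → CutAdmissible A → CutAdmissible B →
                  ⊢ Δ ++ fm (neg (A ∨ B)) ∷ [] → Replacement (A ∨ B) Δ
  replacement-∨ {A} {B} {Δ} cutA cutB e Γ d =
    exchange (↭ₚ.++-comm Δ Γ) (substitute (neg (A ∨ B)) Γ principal e)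
    where
      principal : Replacement (neg (A ∨ B)) Γ
      principal Π eA eB = exchange (↭ₚ.++-comm Γ Π) (ctr {Γ = Γ} {Δ = Π} ΓΠΠ)
        where
          ΓAΠ : ⊢ (Γ ++ fm A ∷ []) ++ Π
          ΓAΠ = cutB (subst ⊢_ (sym (++-assoc Γ (fm A ∷ []) _)) d) eB
          ΓΠA : ⊢ (Γ ++ Π) ++ fm A ∷ []
          ΓΠA = exchange (solve 3 (λ γ α π → (γ ⊕ α) ⊕ π ⊜ (γ ⊕ π) ⊕ α) ↭.refl
                           Γ (fm A ∷ []) Π) ΓAΠ
          ΓΠΠ : ⊢ Γ ++ Π ++ Π
          ΓΠΠ = subst ⊢_ (++-assoc Γ Π Π) (cutA ΓΠA eA)

  replacement-□ : ∀ {A Δ} → CutAdmissible A →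
                  ⊢ Δ ++ fm (neg (□ A)) ∷ [] → Replacement (□ A) Δ
  replacement-□ {A} {Δ} cutA e Γ d =
    exchange (↭ₚ.++-comm Δ Γ) (substitute (neg (□ A)) Γ principal e)
    where
      principal : Replacement (neg (□ A)) Γ
      principal Π Σ e′ =
        exchange (solve 3 (λ σ γ π → σ ⊕ γ ⊕ π ⊜ π ⊕ σ ⊕ γ) ↭.refl (wh Σ ∷ []) Γ Π)
          (cut-inside-wh {X = []} cutA d e′)

  replacement-■ : ∀ {A Δ} → CutAdmissible A →
                  ⊢ Δ ++ fm (neg (■ A)) ∷ [] → Replacement (■ A) Δ
  replacement-■ {A} {Δ} cutA e Γ d =
    exchange (↭ₚ.++-comm Δ Γ) (substitute (neg (■ A)) Γ principal e)
    where
      principal : Replacement (neg (■ A)) Γ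
      principal Π Σ e′ =
        exchange (solve 3 (λ σ γ π → σ ⊕ γ ⊕ π ⊜ π ⊕ σ ⊕ γ) ↭.refl (bl Σ ∷ []) Γ Π)
          (cut-inside-bl {X = []} cutA d e′)

  replacement-◇ : ∀ {A Δ} → CutAdmissible A →
                  ⊢ Δ ++ fm (neg (◇ A)) ∷ [] → Replacement (◇ A) Δ
  replacement-◇ {A} {Δ} cutA e Γ Σ d =
    exchange (solve 3 (λ δ γ σ → δ ⊕ γ ⊕ σ ⊜ γ ⊕ σ ⊕ δ) ↭.refl Δ Γ (wh Σ ∷ []))
      (substitute (neg (◇ A)) (Γ ++ wh Σ ∷ []) principal e)
    where
      principal : Replacement (neg (◇ A)) (Γ ++ wh Σ ∷ [])
      principal Π e′ =
        exchange (solve 3 (λ σ γ π → σ ⊕ γ ⊕ π ⊜ π ⊕ γ ⊕ σ) ↭.refl (wh Σ ∷ []) Γ Π)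
          (subst (λ Σ′ → ⊢ wh Σ′ ∷ Γ ++ Π) (++-identityʳ Σ)
            (cut-inside-wh {Y = []} cutA d e′))

  replacement-◆ : ∀ {A Δ} → CutAdmissible A →
                  ⊢ Δ ++ fm (neg (◆ A)) ∷ [] → Replacement (◆ A) Δ
  replacement-◆ {A} {Δ} cutA e Γ Σ d =
    exchange (solve 3 (λ δ γ σ → δ ⊕ γ ⊕ σ ⊜ γ ⊕ σ ⊕ δ) ↭.refl Δ Γ (bl Σ ∷ []))
      (substitute (neg (◆ A)) (Γ ++ bl Σ ∷ []) principal e)
    where
      principal : Replacement (neg (◆ A)) (Γ ++ bl Σ ∷ [])
      principal Π e′ =
        exchange (solve 3 (λ σ γ π → σ ⊕ γ ⊕ π ⊜ π ⊕ γ ⊕ σ) ↭.refl (bl Σ ∷ []) Γ Π)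
          (subst (λ Σ′ → ⊢ bl Σ′ ∷ Γ ++ Π) (++-identityʳ Σ)
            (cut-inside-bl {Y = []} cutA d e′))

  mutual
    cut-admissible : ∀ A → CutAdmissible A
    cut-admissible A {Δ = Δ} d e = substitute A Δ (replacement A e) d

    replacement : ∀ A {Δ} → ⊢ Δ ++ fm (neg A) ∷ [] → Replacement A Δ
    replacement (atom a)      e Γ = exchange (↭ₚ.++-comm _ Γ) (wk e)
    replacement (natom a) {Δ} e Γ =
      exchange (solve 3 (λ δ α γ → (δ ⊕ α) ⊕ γ ⊜ γ ⊕ α ⊕ δ) ↭.refl Δ (fm (atom a) ∷ []) Γ)
        (wk e)
    replacement (A ∧ B) = replacement-∧ (cut-admissible A) (cut-admissible B)
    replacement (A ∨ B) = replacement-∨ (cut-admissible A) (cut-admissible B)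
    replacement (□ A)   = replacement-□ (cut-admissible A)
    replacement (■ A)   = replacement-■ (cut-admissible A)
    replacement (◇ A)   = replacement-◇ (cut-admissible A)
    replacement (◆ A)   = replacement-◆ (cut-admissible A)

  cut-elimination : ∀ {Γ} → SKt+ SL Γ → ⊢ Γ
  cut-elimination (ex p d)            = ex p (cut-elimination d)
  cut-elimination id                  = id
  cut-elimination (cut {A = A} _ d e) = cut-admissible A (cut-elimination d) (cut-elimination e)
  cut-elimination (∧r d e)            = ∧r (cut-elimination d) (cut-elimination e)
  cut-elimination (∨r d)              = ∨r (cut-elimination d)
  cut-elimination (ctr {Γ} {Δ} d)     = ctr {Γ = Γ} {Δ = Δ} (cut-elimination d)
  cut-elimination (wk {Δ = Δ} d)      = wk {Δ = Δ} (cut-elimination d)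
  cut-elimination (rf d)              = rf (cut-elimination d)
  cut-elimination (rp d)              = rp (cut-elimination d)
  cut-elimination (■r d)              = ■r (cut-elimination d)
  cut-elimination (□r d)              = □r (cut-elimination d)
  cut-elimination (◆r d)              = ◆r (cut-elimination d)
  cut-elimination (◇r d)              = ◇r (cut-elimination d)
  cut-elimination (sl s d)            = sl s (cut-elimination d)

theorem5p5 : (SL : SLSet) (Γ : Seq) → SKt+ SL Γ → SKt+-cutfree SL Γ
theorem5p5 SL Γ = cut-elimination SL
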